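{- Let $n\ge2$, $a\ge1$, $1\le k\le n-1$ be integers, let $\lambda=(a^k,1^{n-k-1},0)$ and let $\mu$ be a partition. If $T$ is a $\lambda\circledast\mu$-peelable tableau, then each of the leftmost $a$ columns of $T$ contains each of the entries $1,3,\ldots,2k-1$.
   Context: English convention: $(i,j)$ is row $i$ (top to bottom), column $j$. For partitions $\lambda,\mu$ the shuffle diagram $D=\lambda\circledast\mu$ has a square at $(2i-1,2j-1)$ for each square $(i,j)$ of the Young diagram of $\lambda$ and at $(2i,2j)$ for each square $(i,j)$ of the Young diagram of $\mu$. For $i\ge1$ let $a_i$ be the number of columns of $D$ containing squares in both rows $i$ and $i+2$. A $\lambda\circledast\mu$-peelable tableau is a semistandard Young tableau with content $(\lambda_1,\mu_1,\lambda_2,\mu_2,\ldots)$ such that for every $i\ge1$ there are at least $a_i$ pairwise disjoint pairs (square containing $i$, square containing $i+2$) in which the $i$-square lies in a row weakly above and a column weakly to the right of the $(i+2)$-square. -}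

module Defs where

open import Data.Nat using (ℕ; zero; suc; _+_; _*_; _∸_; _≤_; _<_; _≥_; _≡ᵇ_; _≤ᵇ_; ⌊_/2⌋)
open import Data.Bool using (Bool; true; false; if_then_else_; _∧_)
open import Data.List using (List; []; _∷_; _++_; replicate; length)
open import Data.Nat.ListAction using (sum)
open import Data.List.Relation.Unary.Linked using (Linked)
open import Data.List.Relation.Unary.All using (All)
open import Data.List.Relation.Unary.AllPairs using (AllPairs)
open import Data.Product using (_×_; _,_; proj₁; proj₂)
open import Relation.Binary.PropositionalEquality using (_≡_; _≢_)

-- Conventions: rows and columns are 1-indexed (English convention, row i top to bottom).

IsPartition : List ℕ → Set
IsPartition = Linked _≥_

-- the i-th part (1-indexed), 0 beyond the list (and for i = 0)
part : List ℕ → ℕ → ℕ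
part []       _             = 0
part (x ∷ xs) zero          = 0
part (x ∷ xs) (suc zero)    = x
part (x ∷ xs) (suc (suc i)) = part xs (suc i)

InShape : List ℕ → ℕ → ℕ → Set
InShape ν r c = 1 ≤ r × 1 ≤ c × c ≤ part ν r

inShapeᵇ : List ℕ → ℕ → ℕ → Bool
inShapeᵇ ν r c = (1 ≤ᵇ r) ∧ ((1 ≤ᵇ c) ∧ (c ≤ᵇ part ν r))

isEven : ℕ → Bool
isEven zero = true
isEven (suc zero) = false
isEven (suc (suc n)) = isEven n

countUpTo : ℕ → (ℕ → Bool) → ℕ
countUpTo zero    p = 0
countUpTo (suc B) p = countUpTo B p + (if p (suc B) then 1 else 0)

sumUpTo : ℕ → (ℕ → ℕ) → ℕ
sumUpTo zero    f = 0
sumUpTo (suc B) f = sumUpTo B f + f (suc B)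

-- semistandard Young tableau (of some partition shape) with positive integer entries;
-- entry r c is only meaningful for squares (r , c) of the shape
record SSYT : Set where
  field
    shape       : List ℕ
    shapePart   : IsPartition shape
    entry       : ℕ → ℕ → ℕ
    positive    : ∀ r c → InShape shape r c → 1 ≤ entry r c
    rowWeak     : ∀ r c → 1 ≤ c → InShape shape r (suc c) → entry r c ≤ entry r (suc c)
    colStrict   : ∀ r c → 1 ≤ r → InShape shape (suc r) c → entry r c < entry (suc r) c
open SSYT public

countEntry : SSYT → ℕ → ℕ
countEntry T v =
  sumUpTo (length (shape T)) (λ r →
    countUpTo (part (shape T) r) (λ c → entry T r c ≡ᵇ v))

-- the content sequence (λ₁, μ₁, λ₂, μ₂, …): value 2i-1 ↦ λᵢ, value 2i ↦ μᵢ
shuffleContent : List ℕ → List ℕ → ℕ → ℕ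
shuffleContent λ' μ v = if isEven v then part μ ⌊ v /2⌋ else part λ' ⌊ suc v /2⌋

HasContent : SSYT → (ℕ → ℕ) → Set
HasContent T cont = ∀ v → 1 ≤ v → countEntry T v ≡ cont v

-- the shuffle diagram λ ⊛ μ : square at (2i-1, 2j-1) for (i,j) ∈ λ and (2i, 2j) for (i,j) ∈ μ
inShuffle : List ℕ → List ℕ → ℕ → ℕ → Bool
inShuffle λ' μ r c =
  if isEven r then (if isEven c then inShapeᵇ μ ⌊ r /2⌋ ⌊ c /2⌋ else false)
  else (if isEven c then false else inShapeᵇ λ' ⌊ suc r /2⌋ ⌊ suc c /2⌋)

-- a_i : number of columns of λ ⊛ μ containing squares in both rows i and i+2
-- (all columns of λ ⊛ μ lie in {1,…, 2(Σλ + Σμ) + 2})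
aCoef : List ℕ → List ℕ → ℕ → ℕ
aCoef λ' μ i = countUpTo (2 * (sum λ' + sum μ) + 2)
  (λ c → inShuffle λ' μ i c ∧ inShuffle λ' μ (i + 2) c)

Cell : Set
Cell = ℕ × ℕ

DisjointPairs : Cell × Cell → Cell × Cell → Set
DisjointPairs (p , q) (p' , q') = p ≢ p' × p ≢ q' × q ≢ p' × q ≢ q'

GoodPair : SSYT → ℕ → Cell × Cell → Set
GoodPair T i ((r₁ , c₁) , (r₂ , c₂)) =
  InShape (shape T) r₁ c₁ × entry T r₁ c₁ ≡ i ×
  InShape (shape T) r₂ c₂ × entry T r₂ c₂ ≡ i + 2 ×
  r₁ ≤ r₂ × c₂ ≤ c₁

Peelable : List ℕ → List ℕ → SSYT → Set
Peelable λ' μ T =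
  HasContent T (shuffleContent λ' μ) ×
  (∀ i → 1 ≤ i → Σ-ex i)
  where
    open import Data.Product using (∃)
    Σ-ex : ℕ → Set
    Σ-ex i = ∃ λ (ps : List (Cell × Cell)) →
      aCoef λ' μ i ≤ length ps × All (GoodPair T i) ps × AllPairs DisjointPairs ps

lamPart : ℕ → ℕ → ℕ → List ℕ
lamPart n a k = replicate k a ++ (replicate (n ∸ k ∸ 1) 1 ++ (0 ∷ []))

-- The odd entries 2m − 1 with m ≤ k occur exactly a times each, because λ₁ = … = λ_k = a.
-- The 1s all lie in the first row and are left-justified there, so they fill the first
-- a columns.  Inductively, once each of the leftmost a columns contains 2m − 1, these are
-- all the occurrences of 2m − 1.  For m < k the shuffle diagram has squares in rows
-- 2m − 1 and 2m + 1 of the columns 1, 3, …, 2a − 1, so peelability provides a disjoint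
-- pairs.  The (2m + 1)-square of a pair lies weakly left of a (2m − 1)-square, hence in
-- one of the first a columns, and by column strictness two such squares in one column
-- coincide; so these a squares occupy a distinct columns among the first a, i.e. all of them.
module Submission where

open import Defs
open import Data.Nat using (ℕ; _≤_; _*_; _∸_)
open import Data.List using (List)
open import Data.Product using (∃; _×_)
open import Relation.Binary.PropositionalEquality using (_≡_)

open import Data.Bool using (Bool; true; false; T; if_then_else_; _∧_)
open import Data.Bool.Properties using (T-∧)
open import Data.Fin using (Fin; toℕ)
open import Data.Fin.Properties using (toℕ<n; toℕ-injective)
open import Data.List using ([]; _∷_; _++_; length; map; filter; replicate; applyUpTo; tabulate)
open import Data.List.Membership.Propositional using (_∈_)
open import Data.List.Membership.Propositional.Properties using (∈-map⁻)
open import Data.List.Properties using (length-map; length-applyUpTo; length-tabulate)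
open import Data.List.Relation.Unary.All as All using (All; []; _∷_)
import Data.List.Relation.Unary.All.Properties as All
open import Data.List.Relation.Unary.AllPairs using (AllPairs; []; _∷_)
import Data.List.Relation.Unary.AllPairs.Properties as AllPairs
import Data.List.Relation.Unary.Linked as Linked
open import Data.List.Relation.Unary.Unique.Propositional using (Unique)
import Data.List.Relation.Unary.Unique.Propositional.Properties as Unique
open import Data.Nat using (zero; suc; _+_; _<_; z≤n; s≤s; s≤s⁻¹; z<s; _≤ᵇ_; _≡ᵇ_; ⌊_/2⌋)
open import Data.Nat.ListAction using (sum)
open import Data.Nat.Properties
open import Data.List.Membership.DecPropositional _≟_ using (_∈?_)
open import Data.Product using (_,_; proj₁; proj₂)
open import Data.Product.Properties using (×-≡,≡→≡)
open import Data.Sum using (inj₁; inj₂)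
open import Function using (_∘_; Equivalence)
open import Relation.Binary.Definitions using (tri<; tri≈; tri>)
open import Relation.Binary.PropositionalEquality using (_≢_; refl; sym; trans; cong; subst; module ≡-Reasoning)
open import Relation.Nullary using (¬_; ¬?; yes; no; does; isYes; contradiction)
open import Relation.Nullary.Decidable using (fromWitness; toWitness; _×-dec_)
open import Relation.Unary using (Decidable)
open import Relation.Unary.Properties using (∁?)

indicator≤1 : ∀ b → (if b then 1 else 0) ≤ 1
indicator≤1 true  = ≤-refl
indicator≤1 false = z≤n

T⇒indicator≡1 : ∀ {b} → T b → (if b then 1 else 0) ≡ 1
T⇒indicator≡1 {true} _ = refl

¬T⇒indicator≡0 : ∀ {b} → ¬ T b → (if b then 1 else 0) ≡ 0
¬T⇒indicator≡0 {true}  ¬t = contradiction _ ¬t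
¬T⇒indicator≡0 {false} _  = refl

length-filter+length-filter-∁ : ∀ {A : Set} {P : A → Set} (P? : Decidable P) xs →
  length (filter P? xs) + length (filter (∁? P?) xs) ≡ length xs
length-filter+length-filter-∁ P? [] = refl
length-filter+length-filter-∁ P? (x ∷ xs) with does (P? x)
... | true  = cong suc (length-filter+length-filter-∁ P? xs)
... | false = trans (+-suc _ _) (cong suc (length-filter+length-filter-∁ P? xs))

unique-constant⇒length≤indicator : ∀ (p : ℕ → Bool) {y xs} → Unique xs → All (λ x → x ≡ y × T (p x)) xs →
  length xs ≤ (if p y then 1 else 0)
unique-constant⇒length≤indicator p _ [] = z≤n
unique-constant⇒length≤indicator p _ ((refl , px) ∷ []) = ≤-reflexive (sym (T⇒indicator≡1 px))
unique-constant⇒length≤indicator p ((x≢x′ ∷ _) ∷ _) ((refl , _) ∷ (refl , _) ∷ _) = contradiction refl x≢x′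

length≤countUpTo : ∀ B (p : ℕ → Bool) {xs} → Unique xs →
  All (λ x → 1 ≤ x × x ≤ B × T (p x)) xs → length xs ≤ countUpTo B p
length≤countUpTo zero    p _ [] = z≤n
length≤countUpTo zero    p _ ((1≤x , x≤0 , _) ∷ _) = contradiction (≤-trans 1≤x x≤0) λ ()
length≤countUpTo (suc B) p {xs} unique xs⊆ = begin
  length xs                                         ≡⟨ length-filter+length-filter-∁ (_≤? B) xs ⟨
  length (filter (_≤? B) xs) + length (filter (∁? (_≤? B)) xs)
    ≤⟨ +-mono-≤ (length≤countUpTo B p (Unique.filter⁺ _ unique) (All.zipWith below (All.all-filter _ xs , All.filter⁺ _ xs⊆)))
                (unique-constant⇒length≤indicator p (Unique.filter⁺ _ unique) (All.zipWith top (All.all-filter _ xs , All.filter⁺ _ xs⊆))) ⟩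
  countUpTo (suc B) p                               ∎
  where
  open ≤-Reasoning
  below : ∀ {x} → x ≤ B × (1 ≤ x × x ≤ suc B × T (p x)) → 1 ≤ x × x ≤ B × T (p x)
  below (x≤B , 1≤x , _ , px) = 1≤x , x≤B , px
  top : ∀ {x} → ¬ x ≤ B × (1 ≤ x × x ≤ suc B × T (p x)) → x ≡ suc B × T (p x)
  top (x≰B , _ , x≤1+B , px) = ≤-antisym x≤1+B (≰⇒> x≰B) , px

allPairs-map-under-All : ∀ {A : Set} {P : A → Set} {R S : A → A → Set} →
  (∀ {x y} → P x → P y → R x y → S x y) → ∀ {xs} → All P xs → AllPairs R xs → AllPairs S xs
allPairs-map-under-All f [] [] = []
allPairs-map-under-All f (px ∷ pxs) (rxs ∷ rs) =
  All.zipWith (λ (py , rxy) → f px py rxy) (pxs , rxs) ∷ allPairs-map-under-All f pxs rs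

unique-columns-in-row : ∀ {r} {cs : List Cell} → All ((r ≡_) ∘ proj₁) cs → Unique cs → Unique (map proj₂ cs)
unique-columns-in-row rows unique = AllPairs.map⁺ (allPairs-map-under-All
  (λ r≡ r≡′ x≢y c≡c′ → x≢y (×-≡,≡→≡ (trans (sym r≡) r≡′ , c≡c′))) rows unique)

InRegion : ℕ → (ℕ → ℕ) → (ℕ → ℕ → Bool) → Cell → Set
InRegion R f q (r , c) = 1 ≤ r × r ≤ R × 1 ≤ c × c ≤ f r × T (q r c)

length≤sumUpTo-countUpTo : ∀ R (f : ℕ → ℕ) (q : ℕ → ℕ → Bool) {cs : List Cell} → Unique cs →
  All (InRegion R f q) cs →
  length cs ≤ sumUpTo R (λ r → countUpTo (f r) (q r))
length≤sumUpTo-countUpTo zero    f q _ [] = z≤n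
length≤sumUpTo-countUpTo zero    f q _ ((1≤r , r≤0 , _) ∷ _) = contradiction (≤-trans 1≤r r≤0) λ ()
length≤sumUpTo-countUpTo (suc R) f q {cs} unique cs⊆ = begin
  length cs                                                 ≡⟨ length-filter+length-filter-∁ ((_≤? R) ∘ proj₁) cs ⟨
  length upperRows + length lastRow                         ≡⟨ cong (length upperRows +_) (length-map proj₂ lastRow) ⟨
  length upperRows + length (map proj₂ lastRow)
    ≤⟨ +-mono-≤ (length≤sumUpTo-countUpTo R f q (Unique.filter⁺ _ unique)
                  (All.zipWith below (All.all-filter _ cs , All.filter⁺ _ cs⊆)))
                (length≤countUpTo (f (suc R)) (q (suc R))
                  (unique-columns-in-row lastRow-rows (Unique.filter⁺ _ unique))
                  (All.map⁺ (All.zipWith inLastRow (lastRow-rows , All.filter⁺ _ cs⊆)))) ⟩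
  sumUpTo (suc R) (λ r → countUpTo (f r) (q r))             ∎
  where
  open ≤-Reasoning
  upperRows lastRow : List Cell
  upperRows = filter ((_≤? R) ∘ proj₁) cs
  lastRow = filter (∁? ((_≤? R) ∘ proj₁)) cs
  lastRow-rows : All ((suc R ≡_) ∘ proj₁) lastRow
  lastRow-rows = All.zipWith (λ (r≰R , _ , r≤1+R , _) → ≤-antisym (≰⇒> r≰R) r≤1+R)
    (All.all-filter _ cs , All.filter⁺ _ cs⊆)
  below : ∀ {x} → proj₁ x ≤ R × InRegion (suc R) f q x → InRegion R f q x
  below (r≤R , 1≤r , _ , rest) = 1≤r , r≤R , rest
  inLastRow : ∀ {x} → suc R ≡ proj₁ x × InRegion (suc R) f q x → 1 ≤ proj₂ x × proj₂ x ≤ f (suc R) × T (q (suc R) (proj₂ x))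
  inLastRow (refl , _ , _ , inColumns) = inColumns

countUpTo≤ : ∀ B p → countUpTo B p ≤ B
countUpTo≤ zero    p = z≤n
countUpTo≤ (suc B) p = ≤-trans (+-mono-≤ (countUpTo≤ B p) (indicator≤1 (p (suc B)))) (≤-reflexive (+-comm B 1))

countUpTo≤-if-false-above : ∀ B j p → (∀ x → j < x → x ≤ B → ¬ T (p x)) → countUpTo B p ≤ j
countUpTo≤-if-false-above zero    j p _ = z≤n
countUpTo≤-if-false-above (suc B) j p false-above with j <? suc B
... | no  j≮1+B = ≤-trans (countUpTo≤ (suc B) p) (≮⇒≥ j≮1+B)
... | yes j<1+B = begin
  countUpTo B p + (if p (suc B) then 1 else 0) ≡⟨ cong (countUpTo B p +_) (¬T⇒indicator≡0 (false-above (suc B) j<1+B ≤-refl)) ⟩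
  countUpTo B p + 0                            ≡⟨ +-identityʳ _ ⟩
  countUpTo B p                                ≤⟨ countUpTo≤-if-false-above B j p (λ x j<x x≤B → false-above x j<x (m≤n⇒m≤1+n x≤B)) ⟩
  j                                            ∎
  where open ≤-Reasoning

countUpTo<-if-false : ∀ B p {y} → 1 ≤ y → y ≤ B → ¬ T (p y) → countUpTo B p < B
countUpTo<-if-false zero    p 1≤y y≤0 _ = contradiction (≤-trans 1≤y y≤0) λ ()
countUpTo<-if-false (suc B) p {y} 1≤y y≤1+B ¬py with y ≤? B
... | yes y≤B = begin-strict
  countUpTo B p + (if p (suc B) then 1 else 0) <⟨ +-mono-<-≤ (countUpTo<-if-false B p 1≤y y≤B ¬py) (indicator≤1 (p (suc B))) ⟩
  B + 1                                        ≡⟨ +-comm B 1 ⟩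
  suc B                                        ∎
  where open ≤-Reasoning
... | no  y≰B with refl ← ≤-antisym y≤1+B (≰⇒> y≰B) = begin-strict
  countUpTo B p + (if p (suc B) then 1 else 0) ≡⟨ cong (countUpTo B p +_) (¬T⇒indicator≡0 ¬py) ⟩
  countUpTo B p + 0                            ≡⟨ +-identityʳ _ ⟩
  countUpTo B p                                ≤⟨ countUpTo≤ B p ⟩
  B                                            <⟨ ≤-refl ⟩
  suc B                                        ∎
  where open ≤-Reasoning

pigeonhole-∈ : ∀ B {xs} → Unique xs → All (λ x → 1 ≤ x × x ≤ B) xs → B ≤ length xs →
  ∀ {y} → 1 ≤ y → y ≤ B → y ∈ xs
pigeonhole-∈ B {xs} unique xs⊆ B≤ {y} 1≤y y≤B with y ∈? xs
... | yes y∈xs = y∈xs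
... | no  y∉xs = contradiction B≤ (<⇒≱ (begin-strict
  length xs    ≤⟨ length≤countUpTo B p unique (All.zipWith (λ (y≢x , 1≤x , x≤B) → 1≤x , x≤B , fromWitness (y≢x ∘ sym))
                    (All.¬Any⇒All¬ xs y∉xs , xs⊆)) ⟩
  countUpTo B p <⟨ countUpTo<-if-false B p 1≤y y≤B (λ py → toWitness py refl) ⟩
  B             ∎))
  where
  open ≤-Reasoning
  p : ℕ → Bool
  p x = isYes (¬? (x ≟ y))

sumUpTo≤first : ∀ R f → (∀ r → 2 ≤ r → r ≤ R → f r ≡ 0) → sumUpTo R f ≤ f 1
sumUpTo≤first zero          f _ = z≤n
sumUpTo≤first (suc zero)    f _ = ≤-refl
sumUpTo≤first (suc (suc R)) f vanish = begin
  sumUpTo (suc R) f + f (suc (suc R)) ≡⟨ cong (sumUpTo (suc R) f +_) (vanish (suc (suc R)) (s≤s (s≤s z≤n)) ≤-refl) ⟩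
  sumUpTo (suc R) f + 0               ≡⟨ +-identityʳ _ ⟩
  sumUpTo (suc R) f                   ≤⟨ sumUpTo≤first (suc R) f (λ r 2≤r r≤R → vanish r 2≤r (m≤n⇒m≤1+n r≤R)) ⟩
  f 1                                 ∎
  where open ≤-Reasoning

part≤head : ∀ {x ν} → IsPartition (x ∷ ν) → part ν 1 ≤ x
part≤head {ν = []}    _       = z≤n
part≤head {ν = _ ∷ _} ordered = Linked.head ordered

part-antitone : ∀ {ν} → IsPartition ν → ∀ {r r′} → 1 ≤ r → r ≤ r′ → part ν r′ ≤ part ν r
part-antitone {[]}    _       _ _ = z≤n
part-antitone {_ ∷ _} ordered {1}           {1}            _ _ = ≤-refl
part-antitone {_ ∷ _} ordered {1}           {suc (suc r′)} _ _ =
  ≤-trans (part-antitone (Linked.tail ordered) {1} {suc r′} ≤-refl (s≤s z≤n)) (part≤head ordered)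
part-antitone {_ ∷ _} ordered {suc (suc r)} {suc (suc r′)} _ (s≤s r≤r′) =
  part-antitone (Linked.tail ordered) (s≤s z≤n) r≤r′

part>0⇒≤length : ∀ ν r → 1 ≤ part ν r → r ≤ length ν
part>0⇒≤length (_ ∷ ν) zero          _ = z≤n
part>0⇒≤length (_ ∷ ν) (suc zero)    _ = s≤s z≤n
part>0⇒≤length (_ ∷ ν) (suc (suc r)) p = s≤s (part>0⇒≤length ν (suc r) p)

HasEntryAt : SSYT → ℕ → Cell → Set
HasEntryAt τ v (r , c) = InShape (shape τ) r c × entry τ r c ≡ v

ColumnContains : SSYT → ℕ → ℕ → Set
ColumnContains τ c v = ∃ λ r → HasEntryAt τ v (r , c)

LeftColumnsContain : SSYT → ℕ → ℕ → Set
LeftColumnsContain τ a v = ∀ c → 1 ≤ c → c ≤ a → ColumnContains τ c v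

lowerColumn : Cell × Cell → ℕ
lowerColumn (_ , (_ , c)) = c

module _ (τ : SSYT) where

  inShape-above : ∀ {r r′ c} → 1 ≤ r → r ≤ r′ → InShape (shape τ) r′ c → InShape (shape τ) r c
  inShape-above 1≤r r≤r′ (_ , 1≤c , c≤part) = 1≤r , 1≤c , ≤-trans c≤part (part-antitone (shapePart τ) 1≤r r≤r′)

  entry-mono-right : ∀ {r c c′} → 1 ≤ c → c ≤ c′ → InShape (shape τ) r c′ → entry τ r c ≤ entry τ r c′
  entry-mono-right {c′ = zero}   1≤c c≤0 _ = contradiction (≤-trans 1≤c c≤0) λ ()
  entry-mono-right {c′ = suc c′} 1≤c c≤1+c′ in-shape@(1≤r , _ , 1+c′≤part) with m≤n⇒m<n∨m≡n c≤1+c′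
  ... | inj₂ refl = ≤-refl
  ... | inj₁ c<1+c′ = ≤-trans
    (entry-mono-right 1≤c (s≤s⁻¹ c<1+c′) (1≤r , ≤-trans 1≤c (s≤s⁻¹ c<1+c′) , <⇒≤ 1+c′≤part))
    (rowWeak τ _ c′ (≤-trans 1≤c (s≤s⁻¹ c<1+c′)) in-shape)

  entry-mono-down : ∀ {r r′ c} → 1 ≤ r → r < r′ → InShape (shape τ) r′ c → entry τ r c < entry τ r′ c
  entry-mono-down {r′ = suc r′} 1≤r r<1+r′ in-shape with m≤n⇒m<n∨m≡n (s≤s⁻¹ r<1+r′)
  ... | inj₂ refl = colStrict τ _ _ 1≤r in-shape
  ... | inj₁ r<r′ = <-trans
    (entry-mono-down 1≤r r<r′ (inShape-above (≤-trans 1≤r (<⇒≤ r<r′)) (n≤1+n r′) in-shape))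
    (colStrict τ r′ _ (≤-trans 1≤r (<⇒≤ r<r′)) in-shape)

  same-entry-in-column⇒same-row : ∀ {v r r′ c} → HasEntryAt τ v (r , c) → HasEntryAt τ v (r′ , c) → r ≡ r′
  same-entry-in-column⇒same-row {r = r} {r′} (in-shape , refl) (in-shape′ , entry≡) with <-cmp r r′
  ... | tri< r<r′ _ _ = contradiction (sym entry≡) (<⇒≢ (entry-mono-down (proj₁ in-shape) r<r′ in-shape′))
  ... | tri≈ _ r≡r′ _ = r≡r′
  ... | tri> _ _ r′<r = contradiction entry≡ (<⇒≢ (entry-mono-down (proj₁ in-shape′) r′<r in-shape))

  length≤countEntry : ∀ {v} {cs : List Cell} → Unique cs → All (HasEntryAt τ v) cs → length cs ≤ countEntry τ v
  length≤countEntry unique cs-hold = length≤sumUpTo-countUpTo _ _ _ unique (All.map inRegion cs-hold)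
    where
    inRegion : ∀ {v x} → HasEntryAt τ v x → InRegion (length (shape τ)) (part (shape τ)) (λ r c → entry τ r c ≡ᵇ v) x
    inRegion {x = r , c} ((1≤r , 1≤c , c≤part) , refl) =
      1≤r , part>0⇒≤length (shape τ) r (≤-trans 1≤c c≤part) , 1≤c , c≤part , ≡⇒≡ᵇ (entry τ r c) _ refl

  no-one-below-first-row : ∀ {r c} → 2 ≤ r → InShape (shape τ) r c → entry τ r c ≢ 1
  no-one-below-first-row 2≤r in-shape entry≡1 = <⇒≱
    (entry-mono-down (s≤s z≤n) 2≤r in-shape)
    (≤-trans (≤-reflexive entry≡1) (positive τ 1 _ (inShape-above ≤-refl (≤-trans (n≤1+n 1) 2≤r) in-shape)))

  countEntry-one≤ : ∀ {c} → ¬ HasEntryAt τ 1 (1 , suc c) → countEntry τ 1 ≤ c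
  countEntry-one≤ {c} no-one-at-1+c = ≤-trans
    (sumUpTo≤first (length (shape τ)) ones-in-row lower-rows-have-no-one)
    (countUpTo≤-if-false-above (part (shape τ) 1) c _ no-one-right-of-c)
    where
    ones-in-row : ℕ → ℕ
    ones-in-row r = countUpTo (part (shape τ) r) (λ x → entry τ r x ≡ᵇ 1)
    lower-rows-have-no-one : ∀ r → 2 ≤ r → r ≤ length (shape τ) → ones-in-row r ≡ 0
    lower-rows-have-no-one r 2≤r _ = n≤0⇒n≡0 (countUpTo≤-if-false-above _ 0 _ λ x 0<x x≤part is-one →
      no-one-below-first-row 2≤r (≤-trans (s≤s z≤n) 2≤r , 0<x , x≤part) (≡ᵇ⇒≡ _ 1 is-one))
    no-one-right-of-c : ∀ x → c < x → x ≤ part (shape τ) 1 → ¬ T (entry τ 1 x ≡ᵇ 1)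
    no-one-right-of-c x c<x x≤part is-one = no-one-at-1+c (in-shape , ≤-antisym
      (≤-trans (entry-mono-right (s≤s z≤n) c<x (s≤s z≤n , ≤-trans (s≤s z≤n) c<x , x≤part)) (≤-reflexive (≡ᵇ⇒≡ _ 1 is-one)))
      (positive τ 1 (suc c) in-shape))
      where
      in-shape : InShape (shape τ) 1 (suc c)
      in-shape = s≤s z≤n , s≤s z≤n , ≤-trans c<x x≤part

  leftColumnsContain-one : ∀ {a} → a ≤ countEntry τ 1 → LeftColumnsContain τ a 1
  leftColumnsContain-one a≤count (suc c) _ 1+c≤a with (suc c ≤? part (shape τ) 1) ×-dec (entry τ 1 (suc c) ≟ 1)
  ... | yes (in-row , is-one) = 1 , (s≤s z≤n , s≤s z≤n , in-row) , is-one
  ... | no  ¬one = contradiction (≤-trans a≤count (countEntry-one≤ λ ((_ , _ , in-row) , is-one) → ¬one (in-row , is-one)))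
                                 (<⇒≱ 1+c≤a)

  leftColumnsContain⇒column≤ : ∀ {a v} → LeftColumnsContain τ a v → countEntry τ v ≤ a →
    ∀ {r c} → HasEntryAt τ v (r , c) → c ≤ a
  leftColumnsContain⇒column≤ {a} {v} cover count≤a {r} {c} holds with c ≤? a
  ... | yes c≤a = c≤a
  ... | no  c≰a = contradiction (≤-trans (length≤countEntry unique all-hold) count≤a)
                                (<⇒≱ (s≤s (≤-reflexive (sym (length-tabulate witness)))))
    where
    witness : Fin a → Cell
    witness i = proj₁ (cover (suc (toℕ i)) (s≤s z≤n) (toℕ<n i)) , suc (toℕ i)
    unique : Unique ((r , c) ∷ tabulate witness)
    unique = All.tabulate⁺ (λ i c≡ → c≰a (subst (_≤ a) (sym (cong proj₂ c≡)) (toℕ<n i)))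
           ∷ Unique.tabulate⁺ (λ witness≡ → toℕ-injective (suc-injective (cong proj₂ witness≡)))
    all-hold : All (HasEntryAt τ v) ((r , c) ∷ tabulate witness)
    all-hold = holds ∷ All.tabulate⁺ (λ i → proj₂ (cover (suc (toℕ i)) (s≤s z≤n) (toℕ<n i)))

  leftColumnsContain-+2 : ∀ {a v ps} → LeftColumnsContain τ a v → countEntry τ v ≤ a →
    All (GoodPair τ v) ps → AllPairs DisjointPairs ps → a ≤ length ps → LeftColumnsContain τ a (v + 2)
  leftColumnsContain-+2 {a} {v} {ps} cover count≤a good disjoint a≤length c 1≤c c≤a
    = lower-square (∈-map⁻ lowerColumn (pigeonhole-∈ a unique-lower in-range a≤length′ 1≤c c≤a))
    where
    distinct-lower : ∀ {pr pr′} → GoodPair τ v pr → GoodPair τ v pr′ → DisjointPairs pr pr′ →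
      lowerColumn pr ≢ lowerColumn pr′
    distinct-lower {_ , (_ , c)} (_ , _ , lower , lower≡ , _) (_ , _ , lower′ , lower′≡ , _) (_ , _ , _ , lower≢lower′) refl =
      lower≢lower′ (cong (_, c) (same-entry-in-column⇒same-row (lower , lower≡) (lower′ , lower′≡)))
    unique-lower : Unique (map lowerColumn ps)
    unique-lower = AllPairs.map⁺ (allPairs-map-under-All distinct-lower good disjoint)
    in-range : All (λ x → 1 ≤ x × x ≤ a) (map lowerColumn ps)
    in-range = All.map⁺ (All.map (λ (upper-in , upper-holds , (_ , 1≤c′ , _) , _ , _ , c′≤c) →
      1≤c′ , ≤-trans c′≤c (leftColumnsContain⇒column≤ cover count≤a (upper-in , upper-holds))) good)
    a≤length′ : a ≤ length (map lowerColumn ps)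
    a≤length′ = ≤-trans a≤length (≤-reflexive (sym (length-map lowerColumn ps)))
    lower-square : ∀ {c} → ∃ (λ pr → pr ∈ ps × c ≡ lowerColumn pr) → ColumnContains τ c (v + 2)
    lower-square (pr , pr∈ps , refl) with (_ , _ , lower-in , lower-holds , _) ← All.lookup good pr∈ps =
      _ , lower-in , lower-holds

odd : ℕ → ℕ
odd t = suc (t + t)

odd+2 : ∀ t → odd t + 2 ≡ odd (suc t)
odd+2 t = cong suc (trans (+-comm (t + t) 2) (cong suc (sym (+-suc t t))))

2*1+m∸1≡odd : ∀ m → 2 * suc m ∸ 1 ≡ odd m
2*1+m∸1≡odd m = trans (+-suc m (m + 0)) (cong (λ x → suc (m + x)) (+-identityʳ m))

isEven-odd : ∀ t → isEven (odd t) ≡ false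
isEven-odd zero    = refl
isEven-odd (suc t) rewrite +-suc t t = isEven-odd t

⌊t+t/2⌋≡t : ∀ t → ⌊ t + t /2⌋ ≡ t
⌊t+t/2⌋≡t zero    = refl
⌊t+t/2⌋≡t (suc t) rewrite +-suc t t = cong suc (⌊t+t/2⌋≡t t)

shuffleContent-odd : ∀ λ′ μ t → shuffleContent λ′ μ (odd t) ≡ part λ′ (suc t)
shuffleContent-odd λ′ μ t rewrite isEven-odd t | ⌊t+t/2⌋≡t t = refl

inShuffle-odd : ∀ λ′ μ j t → inShuffle λ′ μ (odd j) (odd t) ≡ inShapeᵇ λ′ (suc j) (suc t)
inShuffle-odd λ′ μ j t rewrite isEven-odd j | isEven-odd t | ⌊t+t/2⌋≡t j | ⌊t+t/2⌋≡t t = refl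

part-replicate++ : ∀ {k a j} rest → j < k → part (replicate k a ++ rest) (suc j) ≡ a
part-replicate++ {suc k} {j = zero}  rest _ = refl
part-replicate++ {suc k} {j = suc j} rest (s≤s j<k) = part-replicate++ rest j<k

a≤sum-lamPart : ∀ {n a k} → 0 < k → a ≤ sum (lamPart n a k)
a≤sum-lamPart {k = suc _} _ = m≤m+n _ _

module _ {n a k : ℕ} (μ : List ℕ) where

  λ′ : List ℕ
  λ′ = lamPart n a k

  inShuffle-lamPart : ∀ {j t} → j < k → t < a → T (inShuffle λ′ μ (odd j) (odd t))
  inShuffle-lamPart {j} {t} j<k t<a rewrite inShuffle-odd λ′ μ j t =
    subst (T ∘ (suc t ≤ᵇ_)) (sym (part-replicate++ {k} {a} _ j<k)) (≤⇒≤ᵇ t<a)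

  ≤-aCoef-lamPart : ∀ {j} → suc j < k → a ≤ aCoef λ′ μ (odd j)
  ≤-aCoef-lamPart {j} 1+j<k = begin
    a                             ≡⟨ length-applyUpTo odd a ⟨
    length (applyUpTo odd a)      ≤⟨ length≤countUpTo _ _ (Unique.applyUpTo⁺₁ odd a λ i<j _ → <⇒≢ (s≤s (+-mono-< i<j i<j)))
                                       (All.applyUpTo⁺₁ odd a λ t<a → s≤s z≤n , odd≤bound t<a , both-rows t<a) ⟩
    aCoef λ′ μ (odd j)            ∎
    where
    open ≤-Reasoning
    S : ℕ
    S = sum λ′ + sum μ
    a≤S : a ≤ S
    a≤S = ≤-trans (a≤sum-lamPart {n} (<-trans z<s 1+j<k)) (m≤m+n _ (sum μ))
    odd≤bound : ∀ {t} → t < a → odd t ≤ 2 * S + 2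
    odd≤bound {t} t<a = begin
      suc t + t   ≤⟨ +-mono-≤ (≤-trans t<a a≤S) (≤-trans (<⇒≤ t<a) a≤S) ⟩
      S + S       ≡⟨ cong (S +_) (+-identityʳ S) ⟨
      2 * S       ≤⟨ m≤m+n (2 * S) 2 ⟩
      2 * S + 2   ∎
    both-rows : ∀ {t} → t < a → T (inShuffle λ′ μ (odd j) (odd t) ∧ inShuffle λ′ μ (odd j + 2) (odd t))
    both-rows {t} t<a = Equivalence.from T-∧
      ( inShuffle-lamPart (<-trans (n<1+n _) 1+j<k) t<a
      , subst (λ r → T (inShuffle λ′ μ r (odd t))) (sym (odd+2 j)) (inShuffle-lamPart 1+j<k t<a))

module _ {n a k : ℕ} {μ : List ℕ} (τ : SSYT) (peelable : Peelable (lamPart n a k) μ τ) where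

  countEntry-odd : ∀ {m} → m < k → countEntry τ (odd m) ≡ a
  countEntry-odd {m} m<k = begin
    countEntry τ (odd m)                     ≡⟨ proj₁ peelable (odd m) (s≤s z≤n) ⟩
    shuffleContent (lamPart n a k) μ (odd m) ≡⟨ shuffleContent-odd (lamPart n a k) μ m ⟩
    part (lamPart n a k) (suc m)             ≡⟨ part-replicate++ _ m<k ⟩
    a                                        ∎
    where open ≡-Reasoning

  leftColumnsContain-odd : ∀ m → m < k → LeftColumnsContain τ a (odd m)
  leftColumnsContain-odd zero    0<k = leftColumnsContain-one τ (≤-reflexive (sym (countEntry-odd 0<k)))
  leftColumnsContain-odd (suc m) 1+m<k with ps , aCoef≤length , good , disjoint ← proj₂ peelable (odd m) (s≤s z≤n) =
    subst (LeftColumnsContain τ a) (odd+2 m) (leftColumnsContain-+2 τ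
      (leftColumnsContain-odd m (<⇒≤ 1+m<k))
      (≤-reflexive (countEntry-odd (<⇒≤ 1+m<k)))
      good disjoint (≤-trans (≤-aCoef-lamPart μ 1+m<k) aCoef≤length))

lemma4p2 : (n a k : ℕ) → 2 ≤ n → 1 ≤ a → 1 ≤ k → k ≤ n ∸ 1 →
    (μ : List ℕ) → IsPartition μ → (T : SSYT) → Peelable (lamPart n a k) μ T →
    ∀ c → 1 ≤ c → c ≤ a → ∀ m → 1 ≤ m → m ≤ k →
    ∃ λ r → InShape (shape T) r c × entry T r c ≡ 2 * m ∸ 1
lemma4p2 _ _ _ _ _ _ _ _ _ _ _ _ _ _ zero    () _
lemma4p2 n a k _ _ _ _ μ _ T peelable c 1≤c c≤a (suc m) _ 1+m≤k =
  subst (ColumnContains T c) (sym (2*1+m∸1≡odd m)) (leftColumnsContain-odd {μ = μ} T peelable m 1+m≤k c 1≤c c≤a)
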